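{- Let $\mu$ and $\nu$ be distinct strict partitions of the same integer $n$, let $r$ be the largest integer such that $\mu_r\neq\nu_r$, and assume $\mu_r<\nu_r$. Fix pairs of partitions $(\alpha,\beta)$ and $(\alpha',\beta')$ such that $\alpha_1=\alpha'_1=k$ and $|\alpha|+|\beta|=|\alpha'|+|\beta'|=\nu_r+(r-1)$. If the extensions of $\nu$ by these two pairs coincide, then the extensions of $\mu$ by these two pairs also coincide. Moreover, in the case $k=1$, if $\ell(\alpha)>\ell(\alpha')$ and both pairs yield the same extension of $\nu$, then $\ell(\alpha)\ge r$ and $\ell(\alpha')\ge r$.
   Context: A partition is an infinite weakly decreasing sequence of nonnegative integers with finitely many nonzero terms; $|\alpha|$ denotes the sum of its parts (weight), $\ell(\alpha)$ its number of nonzero parts, and it is strict if its nonzero parts are pairwise distinct. For partitions $\nu,\alpha,\beta$, the extension of $\nu$ by the pair $(\alpha,\beta)$ is the partition obtained by adding the columns of $\alpha$ as new columns to the Ferrers board of $\nu$ (giving the partition with parts $\nu_i+\alpha_i$) and then adding the rows of $\beta$ as new rows; i.e. its multiset of nonzero parts is the union of the multiset of nonzero values $\nu_i+\alpha_i$ ($i\ge 1$) and the multiset of nonzero parts of $\beta$. -}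

module Defs where

open import Data.Nat using (ℕ; zero; suc; _+_; _≥_; _>_)
open import Data.List using (List; []; _∷_; _++_)
open import Data.List.Relation.Unary.All using (All)
open import Data.List.Relation.Unary.Linked using (Linked)
open import Data.List.Relation.Binary.Permutation.Propositional using (_↭_)
open import Data.Product using (_×_)

-- A partition is represented by the finite list of its nonzero parts,
-- in weakly decreasing order; all further parts are 0.
IsPartition : List ℕ → Set
IsPartition xs = All (λ x → x > 0) xs × Linked _≥_ xs

IsStrictPartition : List ℕ → Set
IsStrictPartition xs = All (λ x → x > 0) xs × Linked _>_ xs

-- The i-th part (1-based), equal to 0 beyond the length (and for index 0).
part : List ℕ → ℕ → ℕ
part []       _             = 0
part (x ∷ xs) zero          = 0
part (x ∷ xs) (suc zero)    = x
part (x ∷ xs) (suc (suc i)) = part xs (suc i)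

addParts : List ℕ → List ℕ → List ℕ
addParts []       ys       = ys
addParts (x ∷ xs) []       = x ∷ xs
addParts (x ∷ xs) (y ∷ ys) = (x + y) ∷ addParts xs ys

extParts : List ℕ → List ℕ → List ℕ → List ℕ
extParts ν α β = addParts ν α ++ β

-- Two extensions coincide (as partitions) iff their multisets of nonzero parts agree.
SameExt : List ℕ → List ℕ → List ℕ → List ℕ → List ℕ → Set
SameExt ν α β α' β' = extParts ν α β ↭ extParts ν α' β'

module Submission where

-- Write r = m + 1 and index parts from 0, so that ν_r is  at ν m.  The heart of
-- the proof is that equal extensions of the strict partition ν force α and α'
-- to agree in their first r parts (parts-agree).  Suppose j ≤ m is the first
-- index where they differ, say α'_j < α_j.  The part ν_j + α_j of the
-- extension by (α , β) is not of the form ν_i + α'_i (extension-part-missing: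
-- for i < j strictness of ν makes ν_i + α'_i too big, for i ≥ j monotonicity
-- makes it too small), so it is a part of β'.  Then |β'| ≥ ν_j + 1 ≥ ν_r + (m - j) + 1,
-- while |α'| ≥ j because α' has at least j nonzero parts; together this
-- exceeds the weight ν_r + m of (α' , β') (first-difference).
-- Given the agreement, both statements follow quickly: μ and ν only differ in
-- their first r parts, where the extensions by (α , β) and (α' , β') add the
-- same numbers, so cancelling and re-inserting this common block transports
-- the equality from ν to μ (sameExt-transfer); and if ℓ(α') < r, the agreement
-- at index ℓ(α') contradicts ℓ(α) > ℓ(α').

open import Defs
open import Data.Nat using (ℕ; zero; suc; _+_; _∸_; _≤_; _<_; _>_; _≥_; z≤n; s≤s; s≤s⁻¹)
open import Data.Nat.Properties
open import Data.Nat.Induction using (<-rec)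
open import Algebra.Properties.CommutativeSemigroup +-commutativeSemigroup using (x∙yz≈y∙xz)
open import Data.List using (List; []; _∷_; _++_; length; take; drop)
open import Data.List.Properties using (drop-[]; take++drop≡id; ++-assoc)
open import Data.Nat.ListAction using (sum)
open import Data.Product using (_×_; _,_; ∃; proj₁)
open import Data.Sum using (inj₁; inj₂)
open import Data.Empty using (⊥-elim)
open import Relation.Nullary using (¬_; yes; no)
open import Relation.Binary using (tri<; tri≈; tri>)
open import Relation.Binary.PropositionalEquality using (_≡_; _≢_; refl; sym; trans; cong; cong₂; subst)
open import Data.List.Relation.Unary.All using (All; []; _∷_)
open import Data.List.Relation.Unary.Any using (here; there)
open import Data.List.Relation.Unary.Linked as Linked using (Linked; []; [-]; _∷_)
open import Data.List.Membership.Propositional using (_∈_; _∉_)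
open import Data.List.Membership.Propositional.Properties using (∈-++⁻; ∈-++⁺ˡ)
open import Data.List.Relation.Binary.Permutation.Propositional
  using (_↭_; ↭-sym; module PermutationReasoning)
open import Data.List.Relation.Binary.Permutation.Propositional.Properties
  using (∈-resp-↭; ++⁺ˡ; drop-mid)

Positive : List ℕ → Set
Positive = All (λ x → x > 0)

at : List ℕ → ℕ → ℕ
at xs i = part xs (suc i)

at-length : ∀ xs → at xs (length xs) ≡ 0
at-length []       = refl
at-length (x ∷ xs) = at-length xs

at-pos⇒< : ∀ xs i → 0 < at xs i → i < length xs
at-pos⇒< (x ∷ xs) zero    _   = s≤s z≤n
at-pos⇒< (x ∷ xs) (suc i) pos = s≤s (at-pos⇒< xs i pos)

<⇒at-pos : ∀ {xs} → Positive xs → ∀ {i} → i < length xs → 0 < at xs i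
<⇒at-pos (p ∷ _)  {zero}  _         = p
<⇒at-pos (_ ∷ ps) {suc i} (s≤s i<n) = <⇒at-pos ps i<n

at-injective : ∀ {xs ys} → Positive xs → Positive ys →
               (∀ i → at xs i ≡ at ys i) → xs ≡ ys
at-injective []       []       _  = refl
at-injective (p ∷ _)  []       eq = ⊥-elim (<-irrefl (sym (eq 0)) p)
at-injective []       (q ∷ _)  eq = ⊥-elim (<-irrefl (eq 0) q)
at-injective (_ ∷ ps) (_ ∷ qs) eq = cong₂ _∷_ (eq 0) (at-injective ps qs (λ i → eq (suc i)))

take-agree : ∀ {xs ys} → Positive xs → Positive ys → ∀ r →
             (∀ i → i < r → at xs i ≡ at ys i) → take r xs ≡ take r ys
take-agree _        _        zero    _  = refl
take-agree []       []       (suc r) _  = refl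
take-agree (p ∷ _)  []       (suc r) eq = ⊥-elim (<-irrefl (sym (eq 0 (s≤s z≤n))) p)
take-agree []       (q ∷ _)  (suc r) eq = ⊥-elim (<-irrefl (eq 0 (s≤s z≤n)) q)
take-agree (_ ∷ ps) (_ ∷ qs) (suc r) eq =
  cong₂ _∷_ (eq 0 (s≤s z≤n)) (take-agree ps qs r (λ i i<r → eq (suc i) (s≤s i<r)))

drop-agree : ∀ {xs ys} → Positive xs → Positive ys → ∀ r →
             (∀ i → r ≤ i → at xs i ≡ at ys i) → drop r xs ≡ drop r ys
drop-agree ps qs zero eq = at-injective ps qs (λ i → eq i z≤n)
drop-agree []       []       (suc r) _  = refl
drop-agree []       (_ ∷ qs) (suc r) eq =
  trans (sym (drop-[] r)) (drop-agree [] qs r (λ i r≤i → eq (suc i) (s≤s r≤i)))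
drop-agree (_ ∷ ps) []       (suc r) eq =
  trans (drop-agree ps [] r (λ i r≤i → eq (suc i) (s≤s r≤i))) (drop-[] r)
drop-agree (_ ∷ ps) (_ ∷ qs) (suc r) eq = drop-agree ps qs r (λ i r≤i → eq (suc i) (s≤s r≤i))

at-∈ : ∀ xs {i} → i < length xs → at xs i ∈ xs
at-∈ (x ∷ xs) {zero}  _         = here refl
at-∈ (x ∷ xs) {suc i} (s≤s i<n) = there (at-∈ xs i<n)

∈⇒at : ∀ {v} xs → v ∈ xs → ∃ λ i → v ≡ at xs i
∈⇒at (x ∷ xs) (here v≡x) = zero , v≡x
∈⇒at (x ∷ xs) (there v∈xs) with ∈⇒at xs v∈xs
... | i , v≡xᵢ = suc i , v≡xᵢ

addParts-identityʳ : ∀ xs → addParts xs [] ≡ xs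
addParts-identityʳ []       = refl
addParts-identityʳ (x ∷ xs) = refl

at-addParts : ∀ xs ys i → at (addParts xs ys) i ≡ at xs i + at ys i
at-addParts []       ys       i       = refl
at-addParts (x ∷ xs) []       i       = sym (+-identityʳ (at (x ∷ xs) i))
at-addParts (x ∷ xs) (y ∷ ys) zero    = refl
at-addParts (x ∷ xs) (y ∷ ys) (suc i) = at-addParts xs ys i

length-addParts : ∀ xs ys → length xs ≤ length (addParts xs ys)
length-addParts []       ys       = z≤n
length-addParts (x ∷ xs) []       = ≤-refl
length-addParts (x ∷ xs) (y ∷ ys) = s≤s (length-addParts xs ys)

∈-addParts⁺ : ∀ xs ys {i} → i < length xs → at xs i + at ys i ∈ addParts xs ys
∈-addParts⁺ xs ys {i} i<n =
  subst (_∈ addParts xs ys) (at-addParts xs ys i)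
        (at-∈ (addParts xs ys) (≤-trans i<n (length-addParts xs ys)))

∈-addParts⁻ : ∀ {v} xs ys → v ∈ addParts xs ys → ∃ λ i → v ≡ at xs i + at ys i
∈-addParts⁻ xs ys v∈ with ∈⇒at (addParts xs ys) v∈
... | i , v≡ = i , trans v≡ (at-addParts xs ys i)

addParts-take-drop : ∀ r xs ys →
  addParts xs ys ≡ addParts (take r xs) (take r ys) ++ addParts (drop r xs) (drop r ys)
addParts-take-drop zero    xs       ys       = refl
addParts-take-drop (suc r) []       []       = refl
addParts-take-drop (suc r) []       (y ∷ ys) = cong (y ∷_) (sym (take++drop≡id r ys))
addParts-take-drop (suc r) (x ∷ xs) []
  rewrite addParts-identityʳ (drop r xs) = cong (x ∷_) (sym (take++drop≡id r xs))
addParts-take-drop (suc r) (x ∷ xs) (y ∷ ys) = cong (x + y ∷_) (addParts-take-drop r xs ys)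

strict⇒weak : ∀ {xs} → Linked _>_ xs → Linked _≥_ xs
strict⇒weak = Linked.map <⇒≤

head-max : ∀ {x xs} → Linked _≥_ (x ∷ xs) → ∀ j → at (x ∷ xs) j ≤ x
head-max _               zero    = ≤-refl
head-max [-]             (suc j) = z≤n
head-max (x≥y ∷ sorted) (suc j) = ≤-trans (head-max sorted j) x≥y

antitone : ∀ {xs} → Linked _≥_ xs → ∀ {i j} → i ≤ j → at xs j ≤ at xs i
antitone {[]}     _      _         = z≤n
antitone {x ∷ xs} sorted {j = j} z≤n = head-max sorted j
antitone {x ∷ xs} sorted (s≤s i≤j) = antitone (Linked.tail sorted) i≤j

strict-gap : ∀ {xs} → Linked _>_ xs → ∀ i d → i + d < length xs → at xs (i + d) + d ≤ at xs i
strict-gap {x ∷ _} _ zero zero _ = ≤-reflexive (+-identityʳ x)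
strict-gap (x>y ∷ sorted) zero (suc d) (s≤s d<n) =
  ≤-trans (≤-reflexive (+-suc _ d)) (≤-trans (s≤s (strict-gap sorted zero d d<n)) x>y)
strict-gap (_ ∷ sorted) (suc i) d (s≤s i+d<n) = strict-gap sorted i d i+d<n

strict-step : ∀ {xs} → Linked _>_ xs → ∀ {i} → suc i < length xs → at xs (suc i) < at xs i
strict-step (x>y ∷ _)    {zero}  _          = x>y
strict-step (_ ∷ sorted) {suc i} (s≤s i<n)  = strict-step sorted i<n
strict-step [-]          {zero}  (s≤s ())
strict-step [-]          {suc i} (s≤s ())

strict-antitone : ∀ {xs} → Linked _>_ xs → ∀ {i j} → i < j → j < length xs → at xs j < at xs i
strict-antitone sorted i<j j<n =
  ≤-<-trans (antitone (strict⇒weak sorted) i<j) (strict-step sorted (≤-<-trans i<j j<n))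

∈⇒≤sum : ∀ {v} xs → v ∈ xs → v ≤ sum xs
∈⇒≤sum (x ∷ xs) (here refl)  = m≤m+n x (sum xs)
∈⇒≤sum (x ∷ xs) (there v∈xs) = ≤-trans (∈⇒≤sum xs v∈xs) (m≤n+m (sum xs) x)

length≤sum : ∀ {xs} → Positive xs → length xs ≤ sum xs
length≤sum []       = z≤n
length≤sum (p ∷ ps) = +-mono-≤ p (length≤sum ps)

agreeing-prefix-length : ∀ {α} α' → Linked _≥_ α → ∀ j →
  (∀ i → i < j → at α i ≡ at α' i) → 0 < at α j → j ≤ length α'
agreeing-prefix-length α' _      zero    _     _   = z≤n
agreeing-prefix-length α' sorted (suc i) agree pos =
  at-pos⇒< α' i (subst (0 <_) (agree i ≤-refl) (<-≤-trans pos (antitone sorted (n≤1+n i))))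

-- If α and α' first differ at index j, with α'_j < α_j, then the part
-- ν_j + α_j of the extension by α is not a part of the extension of ν by α'
-- coming from ν: a candidate ν_i + α'_i is too large for i < j and too small for i ≥ j.
extension-part-missing : ∀ {ν α α'} → Linked _>_ ν → Linked _≥_ α → Linked _≥_ α' →
  ∀ {j} → j < length ν → (∀ i → i < j → at α i ≡ at α' i) → at α' j < at α j →
  at ν j + at α j ∉ addParts ν α'
extension-part-missing {ν = ν} {α' = α'} sortedν sortedα sortedα' {j} j<n agree α'ⱼ<αⱼ found
  with ∈-addParts⁻ ν α' found
... | i , eq with <-cmp i j
...   | tri< i<j _ _ = <-irrefl eq
        (+-mono-<-≤ (strict-antitone sortedν i<j j<n)
                    (≤-trans (antitone sortedα (<⇒≤ i<j)) (≤-reflexive (agree i i<j))))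
...   | tri≈ _ refl _ = <-irrefl (sym eq) (+-monoʳ-< (at ν j) α'ⱼ<αⱼ)
...   | tri> _ _ j<i = <-irrefl (sym eq)
        (+-mono-≤-< (antitone (strict⇒weak sortedν) (<⇒≤ j<i))
                    (≤-<-trans (antitone sortedα' (<⇒≤ j<i)) α'ⱼ<αⱼ))

-- Hence that part lies in β', which makes (α' , β') heavier than ν_r + (r - 1).
first-difference : ∀ {ν α β α' β'} → Linked _>_ ν → IsPartition α → IsPartition α' →
  SameExt ν α β α' β' → ∀ {j m} → j ≤ m → m < length ν →
  (∀ i → i < j → at α i ≡ at α' i) → at α' j < at α j →
  ¬ (sum α' + sum β' ≡ at ν m + m)
first-difference {ν = ν} {α = α} {α' = α'} {β' = β'} sortedν (_ , sortedα) (posα' , sortedα')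
  same {j} j≤m m<n agree α'ⱼ<αⱼ weight
  with ∈-++⁻ (addParts ν α') (∈-resp-↭ same (∈-++⁺ˡ (∈-addParts⁺ ν α (≤-<-trans j≤m m<n))))
... | inj₁ inν = extension-part-missing sortedν sortedα sortedα' (≤-<-trans j≤m m<n) agree α'ⱼ<αⱼ inν
... | inj₂ inβ' with m≤n⇒∃[o]m+o≡n j≤m
...   | d , refl = <-irrefl (sym weight) heavier
  where
  open ≤-Reasoning
  αⱼ-pos : 0 < at α j
  αⱼ-pos = ≤-<-trans z≤n α'ⱼ<αⱼ
  heavier : at ν (j + d) + (j + d) < sum α' + sum β'
  heavier = begin-strict
    at ν (j + d) + (j + d)   ≡⟨ x∙yz≈y∙xz (at ν (j + d)) j d ⟩
    j + (at ν (j + d) + d)   <⟨ +-monoʳ-< j (≤-<-trans (strict-gap sortedν j d m<n) (m<m+n _ αⱼ-pos)) ⟩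
    j + (at ν j + at α j)    ≤⟨ +-mono-≤ (≤-trans (agreeing-prefix-length α' sortedα j agree αⱼ-pos)
                                                  (length≤sum posα'))
                                         (∈⇒≤sum β' inβ') ⟩
    sum α' + sum β'          ∎

parts-agree : ∀ {ν α β α' β' m} → Linked _>_ ν → IsPartition α → IsPartition α' →
  SameExt ν α β α' β' →
  sum α + sum β ≡ at ν m + m → sum α' + sum β' ≡ at ν m + m → m < length ν →
  ∀ i → i ≤ m → at α i ≡ at α' i
parts-agree {α = α} {α' = α'} {m = m} sortedν pα pα' same weight weight' m<n =
  <-rec (λ i → i ≤ m → at α i ≡ at α' i) step
  where
  Earlier : ℕ → Set
  Earlier j = ∀ {i} → i < j → i ≤ m → at α i ≡ at α' i
  below : ∀ {j} → Earlier j → j ≤ m → ∀ i → i < j → at α i ≡ at α' i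
  below earlier j≤m i i<j = earlier i<j (≤-trans (<⇒≤ i<j) j≤m)
  step : ∀ j → Earlier j → j ≤ m → at α j ≡ at α' j
  step j earlier j≤m with <-cmp (at α' j) (at α j)
  ... | tri< α'ⱼ<αⱼ _ _ =
    ⊥-elim (first-difference sortedν pα pα' same j≤m m<n (below earlier j≤m) α'ⱼ<αⱼ weight')
  ... | tri≈ _ αⱼ≡α'ⱼ _ = sym αⱼ≡α'ⱼ
  ... | tri> _ _ αⱼ<α'ⱼ =
    ⊥-elim (first-difference sortedν pα' pα (↭-sym same) j≤m m<n
              (λ i i<j → sym (below earlier j≤m i i<j)) αⱼ<α'ⱼ weight)

↭-cancelˡ : ∀ zs {xs ys : List ℕ} → zs ++ xs ↭ zs ++ ys → xs ↭ ys
↭-cancelˡ []       p = p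
↭-cancelˡ (z ∷ zs) p = ↭-cancelˡ zs (drop-mid [] [] p)

-- If α and α' have the same first r parts and μ, ν agree after the first r
-- parts, then equal extensions of ν yield equal extensions of μ: the first r
-- parts of both extensions of ν coincide and can be cancelled, and what
-- remains is shared with the extensions of μ.
sameExt-transfer : ∀ r μ ν {α β α' β'} → drop r μ ≡ drop r ν → take r α ≡ take r α' →
  SameExt ν α β α' β' → SameExt μ α β α' β'
sameExt-transfer r μ ν {α} {β} {α'} {β'} tails heads same = begin
  extParts μ α β                ≡⟨ decompose μ α β ⟩
  front μ α ++ back μ α β       ≡⟨ cong (λ t → front μ α ++ (addParts t (drop r α) ++ β)) tails ⟩
  front μ α ++ back ν α β       ↭⟨ ++⁺ˡ (front μ α) backs ⟩
  front μ α ++ back ν α' β'     ≡⟨ cong₂ (λ t u → addParts (take r μ) t ++ (addParts u (drop r α') ++ β'))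
                                         heads (sym tails) ⟩
  front μ α' ++ back μ α' β'    ≡⟨ decompose μ α' β' ⟨
  extParts μ α' β'              ∎
  where
  open PermutationReasoning
  front : List ℕ → List ℕ → List ℕ
  front ρ γ = addParts (take r ρ) (take r γ)
  back : List ℕ → List ℕ → List ℕ → List ℕ
  back ρ γ δ = addParts (drop r ρ) (drop r γ) ++ δ
  decompose : ∀ ρ γ δ → extParts ρ γ δ ≡ front ρ γ ++ back ρ γ δ
  decompose ρ γ δ = trans (cong (_++ δ) (addParts-take-drop r ρ γ)) (++-assoc (front ρ γ) _ δ)
  backs : back ν α β ↭ back ν α' β'
  backs = ↭-cancelˡ (front ν α) (begin
    front ν α ++ back ν α β       ≡⟨ decompose ν α β ⟨
    extParts ν α β                ↭⟨ same ⟩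
    extParts ν α' β'              ≡⟨ decompose ν α' β' ⟩
    front ν α' ++ back ν α' β'    ≡⟨ cong (λ t → addParts (take r ν) t ++ back ν α' β') heads ⟨
    front ν α ++ back ν α' β'     ∎)

agreement-length : ∀ {α} α' {m} → Positive α → (∀ i → i ≤ m → at α i ≡ at α' i) →
  length α' < length α → m < length α'
agreement-length {α} α' {m} posα agree longer with m <? length α'
... | yes m<n = m<n
... | no  m≮n = ⊥-elim (<-irrefl (sym (trans (agree (length α') (≮⇒≥ m≮n)) (at-length α')))
                                  (<⇒at-pos posα longer))

lemma6 : (μ ν α β α' β' : List ℕ) (n r k : ℕ) →
    IsStrictPartition μ → IsStrictPartition ν →
    IsPartition α → IsPartition β → IsPartition α' → IsPartition β' →
    sum μ ≡ n → sum ν ≡ n → μ ≢ ν →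
    1 ≤ r → part μ r ≢ part ν r → (∀ i → r < i → part μ i ≡ part ν i) →
    part μ r < part ν r →
    part α 1 ≡ k → part α' 1 ≡ k →
    sum α + sum β ≡ part ν r + (r ∸ 1) →
    sum α' + sum β' ≡ part ν r + (r ∸ 1) →
    (SameExt ν α β α' β' → SameExt μ α β α' β')
    × (k ≡ 1 → length α > length α' → SameExt ν α β α' β' →
         r ≤ length α × r ≤ length α')
lemma6 μ ν α β α' β' n zero    k _ _ _ _ _ _ _ _ _ () _ _ _ _ _ _ _
lemma6 μ ν α β α' β' n (suc m) k (posμ , _) (posν , sortedν) pα _ pα' _ _ _ _ _ _ after μᵣ<νᵣ _ _
  weight weight' = transfer , lengths
  where
  -- r = m + 1 lies within the length of ν, since ν_r > μ_r ≥ 0.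
  m<ν : m < length ν
  m<ν = at-pos⇒< ν m (≤-<-trans z≤n μᵣ<νᵣ)
  agree : SameExt ν α β α' β' → ∀ i → i ≤ m → at α i ≡ at α' i
  agree same = parts-agree sortedν pα pα' same weight weight' m<ν
  transfer : SameExt ν α β α' β' → SameExt μ α β α' β'
  transfer same = sameExt-transfer (suc m) μ ν
    (drop-agree posμ posν (suc m) (λ i r≤i → after (suc i) (s≤s r≤i)))
    (take-agree (proj₁ pα) (proj₁ pα') (suc m) (λ i i<r → agree same i (s≤s⁻¹ i<r)))
    same
  lengths : k ≡ 1 → length α > length α' → SameExt ν α β α' β' → suc m ≤ length α × suc m ≤ length α'
  lengths _ longer same = ≤-trans r≤α' (<⇒≤ longer) , r≤α'
    where
    r≤α' : suc m ≤ length α'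
    r≤α' = agreement-length α' (proj₁ pα) (agree same) longer
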